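{- Let $\ell$ be a positive integer and let $G^c$ be a connected $c$-edge-coloured multigraph on $n$ vertices with $m \geq c\,\ell + 1$ edges, where $c\geq 4$. Then there exists a colour $c_j$ such that, if all edges of colour $c_j$ are recoloured with another colour and parallel edges with the same colour are deleted (so that only one copy remains), the resulting $(c-1)$-edge-coloured multigraph $G^{c-1}$ is connected and has $m' \geq (c-1)\ell + 1$ edges. Furthermore, if $G^{c-1}$ has a proper Hamiltonian path then $G^c$ has one too, and if $rd(G^c)=c$ then $rd(G^{c-1})=c-1$.
   Context: A $c$-edge-coloured multigraph $G^c$ is a multigraph in which every edge receives one colour from $\{1,\ldots,c\}$ and no two parallel edges joining the same pair of vertices have the same colour; the number of edges counts all edges. The rainbow degree $rd(x)$ of a vertex $x$ is the number of distinct colours on edges incident to $x$, and $rd(G^c)$ is its minimum over all vertices. A path is proper if any two consecutive edges have different colours; a proper Hamiltonian path is a proper path containing all vertices. -}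

module Defs where

open import Data.Nat using (ℕ; zero; suc; _+_; _*_; _⊓_; _<ᵇ_)
open import Data.Bool using (Bool; true; false; if_then_else_; _∨_; _∧_)
open import Data.Fin using (Fin; toℕ; punchIn; _≟_)
open import Data.List using (List; []; _∷_; map; foldr)
open import Data.Nat.ListAction using (sum)
open import Data.Bool.ListAction using (any)
open import Data.List.Base using (allFin)
open import Data.List.Membership.Propositional using (_∈_)
open import Data.List.Relation.Unary.Unique.Propositional using (Unique)
open import Data.List.Relation.Unary.Linked using (Linked)
open import Data.Product using (∃-syntax; _×_)
open import Relation.Binary.PropositionalEquality using (_≡_; _≢_)
open import Relation.Binary.Construct.Closure.ReflexiveTransitive using (Star)
open import Relation.Nullary.Decidable using (⌊_⌋)

-- A c-edge-coloured multigraph on vertex set Fin n: G u v i = true iff there is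
-- an edge of colour i joining u and v.  At most one edge of each colour joins
-- a given pair (no two parallel edges share a colour).
ColGraph : ℕ → ℕ → Set
ColGraph n c = Fin n → Fin n → Fin c → Bool

record IsMultigraph {n c : ℕ} (G : ColGraph n c) : Set where
  field
    sym    : ∀ u v i → G u v i ≡ G v u i
    irrefl : ∀ u i → G u u i ≡ false

Adj : {n c : ℕ} → ColGraph n c → Fin n → Fin n → Set
Adj G u v = ∃[ i ] G u v i ≡ true

Connected : {n c : ℕ} → ColGraph n c → Set
Connected G = ∀ u v → Star (Adj G) u v

count : {k : ℕ} → (Fin k → Bool) → ℕ
count {k} p = sum (map (λ i → if p i then 1 else 0) (allFin k))

edges : {n c : ℕ} → ColGraph n c → ℕ
edges {n} G = sum (map (λ u → sum (map (λ v →
  if toℕ u <ᵇ toℕ v then count (G u v) else 0) (allFin n))) (allFin n))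

rd : {n c : ℕ} → ColGraph n c → Fin n → ℕ
rd {n} G x = count (λ i → any (λ v → G x v i) (allFin n))

-- rd(G): minimum rainbow degree over all vertices (the empty minimum is c)
rdG : {n c : ℕ} → ColGraph n c → ℕ
rdG {n} {c} G = foldr (λ x acc → rd G x ⊓ acc) c (allFin n)

-- walk x0 x1 ... with edge colours c1 c2 ... (edge x_{t-1} x_t has colour c_t)
data Walk {n c : ℕ} (G : ColGraph n c) : List (Fin n) → List (Fin c) → Set where
  nil    : Walk G [] []
  single : ∀ x → Walk G (x ∷ []) []
  step   : ∀ {x y i vs cs} → G x y i ≡ true → Walk G (y ∷ vs) cs →
           Walk G (x ∷ y ∷ vs) (i ∷ cs)

record ProperHamPath {n c : ℕ} (G : ColGraph n c) : Set where
  field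
    vs     : List (Fin n)
    cs     : List (Fin c)
    walk   : Walk G vs cs
    proper : Linked _≢_ cs
    uniq   : Unique vs
    cover  : ∀ x → x ∈ vs

-- Recolour every edge of colour j with colour k, merging parallel edges of
-- equal colour; the remaining colours (all but j) are relabelled to Fin c
-- via punchIn j, giving a c-edge-coloured multigraph from a (suc c)-one.
recolour : {n c : ℕ} → ColGraph n (suc c) → Fin (suc c) → Fin (suc c) → ColGraph n c
recolour G j k u v i = G u v (punchIn j i) ∨ (⌊ punchIn j i ≟ k ⌋ ∧ G u v j)

-- Some colour class j carries at most a 1/c share of the m ≥ cℓ + 1 edges, so merging it
-- into any other colour k loses at most m/c edges and leaves more than (c − 1)ℓ of them.
-- Merging never removes an adjacency, so connectivity survives, and every colour other than
-- j survives at every vertex, so a full rainbow degree c becomes c − 1. A proper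
-- Hamiltonian path of the merged graph lifts to G: each merged colour is replaced by a
-- colour of G it came from, and distinct merged colours come from distinct colours of G.
module Submission where

open import Defs
open import Data.Nat.Properties hiding (_≟_)
open import Algebra.Properties.CommutativeMonoid.Sum +-0-commutativeMonoid
  using (sum; sum-syntax; ∑-comm; ∑-distrib-+; sum-remove; sum-cong-≗)
open import Data.Bool using (Bool; true; false; if_then_else_; _∨_; _∧_)
open import Data.Bool.ListAction using (any)
open import Data.Bool.Properties using (∨-zeroʳ)
open import Data.Empty using (⊥-elim)
open import Data.Fin using (Fin; zero; suc; toℕ; punchIn; punchOut; _≟_)
open import Data.Fin.Properties using (punchIn-injective; punchInᵢ≢i; punchIn-punchOut)
open import Data.List using (List; []; _∷_; map; foldr; tabulate; allFin)
open import Data.List.Extrema.Nat using (argmin; f[argmin]≤f[xs])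
open import Data.List.Membership.Propositional using (_∈_)
open import Data.List.Membership.Propositional.Properties using (∈-allFin)
open import Data.List.Properties using (map-tabulate)
open import Data.List.Relation.Binary.Pointwise using (Pointwise; []; _∷_)
open import Data.List.Relation.Unary.All as All using (All)
open import Data.List.Relation.Unary.Any using (here; there)
open import Data.List.Relation.Unary.Linked using (Linked; []; [-]; _∷_)
open import Data.Nat using (ℕ; zero; suc; _+_; _*_; _≤_; _<_; _⊓_; _<ᵇ_; z≤n; s≤s)
import Data.Nat.ListAction as List
open import Data.Product using (∃-syntax; _×_; _,_)
open import Function using (_∘_; id)
open import Relation.Nullary.Decidable using (yes; no; ⌊_⌋)
open import Relation.Binary.PropositionalEquality
  using (_≡_; _≢_; refl; sym; trans; cong; subst; module ≡-Reasoning)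
import Relation.Binary.Construct.Closure.ReflexiveTransitive as Star

sum-tabulate : ∀ {k} (f : Fin k → ℕ) → List.sum (tabulate f) ≡ sum f
sum-tabulate {zero}  f = refl
sum-tabulate {suc k} f = cong (f zero +_) (sum-tabulate (f ∘ suc))

sum-map-allFin : ∀ {k} (f : Fin k → ℕ) → List.sum (map f (allFin k)) ≡ sum f
sum-map-allFin f = trans (cong List.sum (map-tabulate id f)) (sum-tabulate f)

sum-mono-≤ : ∀ {k} {f g : Fin k → ℕ} → (∀ i → f i ≤ g i) → sum f ≤ sum g
sum-mono-≤ {zero}  f≤g = z≤n
sum-mono-≤ {suc k} f≤g = +-mono-≤ (f≤g zero) (sum-mono-≤ (f≤g ∘ suc))

sum-const : ∀ k c → ∑[ i < k ] c ≡ k * c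
sum-const zero    c = refl
sum-const (suc k) c = cong (c +_) (sum-const k c)

sum-if : ∀ {k} b (f : Fin k → ℕ) → ∑[ i < k ] (if b then f i else 0) ≡ (if b then sum f else 0)
sum-if         true  f = refl
sum-if {k = k} false f = trans (sum-const k 0) (*-zeroʳ k)

lightest-below-average : ∀ {k} (f : Fin (suc k) → ℕ) → ∃[ j ] suc k * f j ≤ sum f
lightest-below-average {k} f = j , (begin
  suc k * f j       ≡⟨ sum-const (suc k) (f j) ⟨
  ∑[ i < suc k ] f j ≤⟨ sum-mono-≤ (λ i → All.lookup j-minimal (∈-allFin i)) ⟩
  sum f             ∎)
  where
  open ≤-Reasoning
  j : Fin (suc k)
  j = argmin f zero (allFin (suc k))
  j-minimal : All (λ i → f j ≤ f i) (allFin (suc k))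
  j-minimal = f[argmin]≤f[xs] {f = f} zero (allFin (suc k))

𝟙 : Bool → ℕ
𝟙 b = if b then 1 else 0

count≡sum : ∀ {k} (p : Fin k → Bool) → count p ≡ ∑[ i < k ] 𝟙 (p i)
count≡sum p = sum-map-allFin (𝟙 ∘ p)

sum-𝟙≤ : ∀ {k} (p : Fin k → Bool) → ∑[ i < k ] 𝟙 (p i) ≤ k
sum-𝟙≤ {zero}  p = z≤n
sum-𝟙≤ {suc k} p = +-mono-≤ (𝟙≤1 (p zero)) (sum-𝟙≤ (p ∘ suc))
  where
  𝟙≤1 : ∀ b → 𝟙 b ≤ 1
  𝟙≤1 true  = ≤-refl
  𝟙≤1 false = z≤n

count≤ : ∀ {k} (p : Fin k → Bool) → count p ≤ k
count≤ p = subst (_≤ _) (sym (count≡sum p)) (sum-𝟙≤ p)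

count≡size⇒all : ∀ {k} (p : Fin k → Bool) → count p ≡ k → ∀ i → p i ≡ true
count≡size⇒all p eq = sum-𝟙≡size⇒all p (trans (sym (count≡sum p)) eq)
  where
  sum-𝟙≡size⇒all : ∀ {k} (p : Fin k → Bool) → ∑[ i < k ] 𝟙 (p i) ≡ k → ∀ i → p i ≡ true
  sum-𝟙≡size⇒all {suc k} p eq i with p zero in p0
  sum-𝟙≡size⇒all {suc k} p eq zero    | true  = p0
  sum-𝟙≡size⇒all {suc k} p eq (suc i) | true  = sum-𝟙≡size⇒all (p ∘ suc) (suc-injective eq) i
  sum-𝟙≡size⇒all {suc k} p eq i       | false = ⊥-elim (<⇒≱ ≤-refl (subst (_≤ k) eq (sum-𝟙≤ (p ∘ suc))))

all⇒count≡size : ∀ {k} (p : Fin k → Bool) → (∀ i → p i ≡ true) → count p ≡ k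
all⇒count≡size p all = trans (count≡sum p) (all⇒sum-𝟙≡size p all)
  where
  all⇒sum-𝟙≡size : ∀ {k} (p : Fin k → Bool) → (∀ i → p i ≡ true) → ∑[ i < k ] 𝟙 (p i) ≡ k
  all⇒sum-𝟙≡size {zero}  p all = refl
  all⇒sum-𝟙≡size {suc k} p all rewrite all zero = cong suc (all⇒sum-𝟙≡size (p ∘ suc) (all ∘ suc))

any-mono : ∀ {A : Set} {p q : A → Bool} → (∀ x → p x ≡ true → q x ≡ true) →
           ∀ xs → any p xs ≡ true → any q xs ≡ true
any-mono {p = p} {q} p⇒q (x ∷ xs) any-p with p x in px
... | true  = cong (_∨ any q xs) (p⇒q x px)
... | false = trans (cong (q x ∨_) (any-mono p⇒q xs any-p)) (∨-zeroʳ (q x))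

module _ {A : Set} (g : A → ℕ) (c : ℕ) where

  minFold : List A → ℕ
  minFold = foldr (λ x acc → g x ⊓ acc) c

  minFold≤ : ∀ xs → minFold xs ≤ c
  minFold≤ []       = ≤-refl
  minFold≤ (x ∷ xs) = ≤-trans (m⊓n≤n (g x) (minFold xs)) (minFold≤ xs)

  minFold≡bound⇒≡bound : (∀ x → g x ≤ c) → ∀ xs → minFold xs ≡ c → ∀ {x} → x ∈ xs → g x ≡ c
  minFold≡bound⇒≡bound g≤c (y ∷ xs) eq (here refl) =
    ≤-antisym (g≤c y) (subst (_≤ g y) eq (m⊓n≤m (g y) (minFold xs)))
  minFold≡bound⇒≡bound g≤c (y ∷ xs) eq (there x∈xs) =
    minFold≡bound⇒≡bound g≤c xs
      (≤-antisym (minFold≤ xs) (subst (_≤ minFold xs) eq (m⊓n≤n (g y) (minFold xs)))) x∈xs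

  ≡bound⇒minFold≡bound : (∀ x → g x ≡ c) → ∀ xs → minFold xs ≡ c
  ≡bound⇒minFold≡bound g≡c []       = refl
  ≡bound⇒minFold≡bound g≡c (x ∷ xs) rewrite g≡c x | ≡bound⇒minFold≡bound g≡c xs = ⊓-idem c

upper : ∀ {n} → (Fin n → Fin n → ℕ) → Fin n → Fin n → ℕ
upper h u v = if toℕ u <ᵇ toℕ v then h u v else 0

sumPairs : ∀ {n} → (Fin n → Fin n → ℕ) → ℕ
sumPairs {n} h = ∑[ u < n ] ∑[ v < n ] upper h u v

sumPairs-cong : ∀ {n} {h h' : Fin n → Fin n → ℕ} → (∀ u v → h u v ≡ h' u v) →
                sumPairs h ≡ sumPairs h'
sumPairs-cong h≡h' =
  sum-cong-≗ (λ u → sum-cong-≗ (λ v → cong (λ x → if toℕ u <ᵇ toℕ v then x else 0) (h≡h' u v)))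

sumPairs-mono-≤ : ∀ {n} {h h' : Fin n → Fin n → ℕ} → (∀ u v → h u v ≤ h' u v) →
                  sumPairs h ≤ sumPairs h'
sumPairs-mono-≤ h≤h' = sum-mono-≤ (λ u → sum-mono-≤ (λ v → if-mono (toℕ u <ᵇ toℕ v) (h≤h' u v)))
  where
  if-mono : ∀ b {x y} → x ≤ y → (if b then x else 0) ≤ (if b then y else 0)
  if-mono true  x≤y = x≤y
  if-mono false x≤y = z≤n

sumPairs-+ : ∀ {n} (h h' : Fin n → Fin n → ℕ) →
             sumPairs (λ u v → h u v + h' u v) ≡ sumPairs h + sumPairs h'
sumPairs-+ {n} h h' = begin
  ∑[ u < n ] ∑[ v < n ] upper (λ u v → h u v + h' u v) u v
    ≡⟨ sum-cong-≗ (λ u → sum-cong-≗ (upper-+ u)) ⟩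
  ∑[ u < n ] ∑[ v < n ] (upper h u v + upper h' u v)
    ≡⟨ sum-cong-≗ (λ u → ∑-distrib-+ (upper h u) (upper h' u)) ⟩
  ∑[ u < n ] (∑[ v < n ] upper h u v + ∑[ v < n ] upper h' u v)
    ≡⟨ ∑-distrib-+ (λ u → ∑[ v < n ] upper h u v) (λ u → ∑[ v < n ] upper h' u v) ⟩
  sumPairs h + sumPairs h' ∎
  where
  open ≡-Reasoning
  upper-+ : ∀ u v → upper (λ u v → h u v + h' u v) u v ≡ upper h u v + upper h' u v
  upper-+ u v with toℕ u <ᵇ toℕ v
  ... | true  = refl
  ... | false = refl

∑-sumPairs : ∀ {c n} (h : Fin c → Fin n → Fin n → ℕ) →
             ∑[ i < c ] sumPairs (h i) ≡ sumPairs (λ u v → ∑[ i < c ] h i u v)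
∑-sumPairs {c} {n} h = begin
  ∑[ i < c ] ∑[ u < n ] ∑[ v < n ] upper (h i) u v
    ≡⟨ ∑-comm (λ i u → ∑[ v < n ] upper (h i) u v) ⟩
  ∑[ u < n ] ∑[ i < c ] ∑[ v < n ] upper (h i) u v
    ≡⟨ sum-cong-≗ (λ u → ∑-comm (λ i v → upper (h i) u v)) ⟩
  ∑[ u < n ] ∑[ v < n ] ∑[ i < c ] upper (h i) u v
    ≡⟨ sum-cong-≗ (λ u → sum-cong-≗ (λ v → sum-if (toℕ u <ᵇ toℕ v) (λ i → h i u v))) ⟩
  sumPairs (λ u v → ∑[ i < c ] h i u v) ∎
  where open ≡-Reasoning

edges≡sumPairs : ∀ {n c} (G : ColGraph n c) → edges G ≡ sumPairs (λ u v → count (G u v))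
edges≡sumPairs {n} G =
  trans (sum-map-allFin (λ u → List.sum (map (upper count-G u) (allFin n))))
        (sum-cong-≗ (λ u → sum-map-allFin (upper count-G u)))
  where
  count-G : Fin n → Fin n → ℕ
  count-G u v = count (G u v)

colourEdges : ∀ {n c} → ColGraph n c → Fin c → ℕ
colourEdges G i = sumPairs (λ u v → 𝟙 (G u v i))

∑-colourEdges : ∀ {n c} (G : ColGraph n c) → ∑[ i < c ] colourEdges G i ≡ edges G
∑-colourEdges G = begin
  ∑[ i < _ ] colourEdges G i                  ≡⟨ ∑-sumPairs (λ i u v → 𝟙 (G u v i)) ⟩
  sumPairs (λ u v → ∑[ i < _ ] 𝟙 (G u v i))   ≡⟨ sumPairs-cong (λ u v → count≡sum (G u v)) ⟨
  sumPairs (λ u v → count (G u v))            ≡⟨ edges≡sumPairs G ⟨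
  edges G                                     ∎
  where open ≡-Reasoning

module _ {n d : ℕ} (G : ColGraph n (suc d)) (j k : Fin (suc d)) where

  recolour-keeps : ∀ {u v i} → G u v (punchIn j i) ≡ true → recolour G j k u v i ≡ true
  recolour-keeps {u} {v} {i} e = cong (_∨ (⌊ punchIn j i ≟ k ⌋ ∧ G u v j)) e

  recolour-merges : ∀ {u v} (k≢j : k ≢ j) → G u v j ≡ true →
                    recolour G j k u v (punchOut (k≢j ∘ sym)) ≡ true
  recolour-merges {u} {v} k≢j e rewrite punchIn-punchOut (k≢j ∘ sym) | e with k ≟ k
  ... | yes _   = ∨-zeroʳ (G u v k)
  ... | no  k≢k = ⊥-elim (k≢k refl)

  adj-recolour : k ≢ j → ∀ {u v} → Adj G u v → Adj (recolour G j k) u v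
  adj-recolour k≢j {u} {v} (i , e) with i ≟ j
  ... | yes refl = punchOut (k≢j ∘ sym) , recolour-merges k≢j e
  ... | no  i≢j  = punchOut (i≢j ∘ sym) ,
                   recolour-keeps (trans (cong (G u v) (punchIn-punchOut (i≢j ∘ sym))) e)

  connected-recolour : k ≢ j → Connected G → Connected (recolour G j k)
  connected-recolour k≢j conn u v = Star.map (adj-recolour k≢j) (conn u v)

  count-recolour : ∀ u v → count (G u v) ≤ count (recolour G j k u v) + 𝟙 (G u v j)
  count-recolour u v = begin
    count (G u v)
      ≡⟨ count≡sum (G u v) ⟩
    ∑[ i < suc d ] 𝟙 (G u v i)
      ≡⟨ sum-remove {i = j} (𝟙 ∘ G u v) ⟩
    𝟙 (G u v j) + ∑[ i < d ] 𝟙 (G u v (punchIn j i))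
      ≤⟨ +-monoʳ-≤ (𝟙 (G u v j)) (sum-mono-≤ (λ i → 𝟙-∨ (G u v (punchIn j i)) _)) ⟩
    𝟙 (G u v j) + ∑[ i < d ] 𝟙 (recolour G j k u v i)
      ≡⟨ +-comm (𝟙 (G u v j)) _ ⟩
    ∑[ i < d ] 𝟙 (recolour G j k u v i) + 𝟙 (G u v j)
      ≡⟨ cong (_+ 𝟙 (G u v j)) (count≡sum (recolour G j k u v)) ⟨
    count (recolour G j k u v) + 𝟙 (G u v j) ∎
    where
    open ≤-Reasoning
    𝟙-∨ : ∀ a b → 𝟙 a ≤ 𝟙 (a ∨ b)
    𝟙-∨ true  b = ≤-refl
    𝟙-∨ false b = z≤n

  edges-recolour : edges G ≤ edges (recolour G j k) + colourEdges G j
  edges-recolour = begin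
    edges G
      ≡⟨ edges≡sumPairs G ⟩
    sumPairs (λ u v → count (G u v))
      ≤⟨ sumPairs-mono-≤ count-recolour ⟩
    sumPairs (λ u v → count (recolour G j k u v) + 𝟙 (G u v j))
      ≡⟨ sumPairs-+ (λ u v → count (recolour G j k u v)) (λ u v → 𝟙 (G u v j)) ⟩
    sumPairs (λ u v → count (recolour G j k u v)) + colourEdges G j
      ≡⟨ cong (_+ colourEdges G j) (edges≡sumPairs (recolour G j k)) ⟨
    edges (recolour G j k) + colourEdges G j ∎
    where open ≤-Reasoning

  rdG-recolour : rdG G ≡ suc d → rdG (recolour G j k) ≡ d
  rdG-recolour rdG≡c =
    ≡bound⇒minFold≡bound (rd (recolour G j k)) d
      (λ x → all⇒count≡size _ (λ i → any-mono (λ v → recolour-keeps) (allFin n) (allAt x (punchIn j i))))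
      (allFin n)
    where
    allAt : ∀ x i → any (λ v → G x v i) (allFin n) ≡ true
    allAt x = count≡size⇒all _
      (minFold≡bound⇒≡bound (rd G) (suc d) (λ y → count≤ _) (allFin n) rdG≡c (∈-allFin x))

module _ {n d : ℕ} (G : ColGraph n (suc d)) (j k : Fin (suc d)) where

  data Origin (i : Fin d) (o : Fin (suc d)) : Set where
    kept   : o ≡ punchIn j i → Origin i o
    merged : o ≡ j → punchIn j i ≡ k → Origin i o

  Origin-injective : ∀ {i i' o} → Origin i o → Origin i' o → i ≡ i'
  Origin-injective (kept o≡i)     (kept o≡i')     = punchIn-injective j _ _ (trans (sym o≡i) o≡i')
  Origin-injective (kept o≡i)     (merged o≡j _)  = ⊥-elim (punchInᵢ≢i j _ (trans (sym o≡i) o≡j))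
  Origin-injective (merged o≡j _) (kept o≡i')     = ⊥-elim (punchInᵢ≢i j _ (trans (sym o≡i') o≡j))
  Origin-injective (merged _ i↦k) (merged _ i'↦k) = punchIn-injective j _ _ (trans i↦k (sym i'↦k))

  origin : ∀ {u v i} → recolour G j k u v i ≡ true → ∃[ o ] G u v o ≡ true × Origin i o
  origin {u} {v} {i} e with G u v (punchIn j i) in kept-edge | punchIn j i ≟ k
  origin {u} {v} {i} e  | true  | _       = punchIn j i , kept-edge , kept refl
  origin {u} {v} {i} e  | false | yes i↦k = j , e , merged refl i↦k
  origin {u} {v} {i} () | false | no  _

  liftWalk : ∀ {vs cs} → Walk (recolour G j k) vs cs →
             ∃[ cs' ] Walk G vs cs' × Pointwise Origin cs cs'
  liftWalk nil        = [] , nil , []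
  liftWalk (single x) = [] , single x , []
  liftWalk (step e w) with origin e | liftWalk w
  ... | o , e' , o↤i | os , w' , os↤is = o ∷ os , step e' w' , o↤i ∷ os↤is

  proper-lift : ∀ {cs cs'} → Pointwise Origin cs cs' → Linked _≢_ cs → Linked _≢_ cs'
  proper-lift []                 []            = []
  proper-lift (_ ∷ [])           [-]           = [-]
  proper-lift (o₁ ∷ o₂ ∷ os↤is) (i₁≢i₂ ∷ cs) =
    (λ { refl → i₁≢i₂ (Origin-injective o₁ o₂) }) ∷ proper-lift (o₂ ∷ os↤is) cs

  properHamPath-lift : ProperHamPath (recolour G j k) → ProperHamPath G
  properHamPath-lift P with liftWalk (ProperHamPath.walk P)
  ... | cs' , w' , cs'↤cs = record
    { vs     = ProperHamPath.vs P
    ; cs     = cs'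
    ; walk   = w'
    ; proper = proper-lift cs'↤cs (ProperHamPath.proper P)
    ; uniq   = ProperHamPath.uniq P
    ; cover  = ProperHamPath.cover P
    }

light-loss : ∀ {d ℓ m m' e} → 1 ≤ d → suc d * e ≤ m → m ≤ m' + e → suc d * ℓ < m → d * ℓ < m'
light-loss {d} {ℓ} {m} {m'} {e} d≥1 ce≤m m≤m'+e cℓ<m = *-cancelˡ-< (suc d) (d * ℓ) m' (begin-strict
  suc d * (d * ℓ)       ≡⟨ *-assoc (suc d) d ℓ ⟨
  suc d * d * ℓ         ≡⟨ cong (_* ℓ) (*-comm (suc d) d) ⟩
  d * suc d * ℓ         ≡⟨ *-assoc d (suc d) ℓ ⟩
  d * (suc d * ℓ)       <⟨ m<n+m _ d≥1 ⟩
  d + d * (suc d * ℓ)   ≡⟨ *-suc d (suc d * ℓ) ⟨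
  d * suc (suc d * ℓ)   ≤⟨ *-monoʳ-≤ d cℓ<m ⟩
  d * m                 ≤⟨ dm≤cm' ⟩
  suc d * m'            ∎)
  where
  open ≤-Reasoning
  dm≤cm' : d * m ≤ suc d * m'
  dm≤cm' = +-cancelʳ-≤ m (d * m) (suc d * m') (begin
    d * m + m               ≡⟨ +-comm (d * m) m ⟩
    suc d * m               ≤⟨ *-monoʳ-≤ (suc d) m≤m'+e ⟩
    suc d * (m' + e)        ≡⟨ *-distribˡ-+ (suc d) m' e ⟩
    suc d * m' + suc d * e  ≤⟨ +-monoʳ-≤ (suc d * m') ce≤m ⟩
    suc d * m' + m          ∎)

lemma4p1 : (ℓ : ℕ) → 1 ≤ ℓ → (n d : ℕ) → (G : ColGraph n (suc d)) →
    IsMultigraph G → 4 ≤ suc d → Connected G → suc d * ℓ + 1 ≤ edges G →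
    ∃[ j ] ((k : Fin (suc d)) → k ≢ j →
      Connected (recolour G j k)
      × d * ℓ + 1 ≤ edges (recolour G j k)
      × (ProperHamPath (recolour G j k) → ProperHamPath G)
      × (rdG G ≡ suc d → rdG (recolour G j k) ≡ d))
lemma4p1 ℓ _ n d G _ (s≤s 3≤d) conn many-edges =
  let j , j-light = lightest-below-average (colourEdges G) in
  j , λ k k≢j →
    connected-recolour G j k k≢j conn
  , subst (_≤ edges (recolour G j k)) (+-comm 1 (d * ℓ))
      (light-loss (≤-trans (s≤s z≤n) 3≤d)
        (subst (suc d * colourEdges G j ≤_) (∑-colourEdges G) j-light)
        (edges-recolour G j k)
        (subst (_≤ edges G) (+-comm (suc d * ℓ) 1) many-edges))
  , properHamPath-lift G j k
  , rdG-recolour G j k
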